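{- Let $r\ge1$ and let $p_{i_{\tilde u_j}}(\ell_1,\dots,\ell_r;k,m,n)$ be as in the context. For $1\le j\le 2^r-2$ and all integers $\ell_1,\dots,\ell_r,k,m,n$: $$p_{0_{\tilde u_j}}(\ell_1,\dots,\ell_r;k,m,n)-p_{0_{\tilde u_{j+1}}}(\ell_1,\dots,\ell_r;k,m,n)=p_{0_{v(\tilde u_j)}}(\ell_1-\epsilon_1(j),\dots,\ell_r-\epsilon_r(j);k,m-1,n-(m-1)w(\tilde u_j))$$ $$\qquad+\,p_{0_{v(\tilde u_j)}}(\ell_1-\epsilon_1(j),\dots,\ell_r-\epsilon_r(j);k-1,m-1,n-(m-1)(w(\tilde u_j)-1));$$ moreover $$p_{0_{\tilde u_{2^r-1}}}(\ell_1,\dots,\ell_r;k,m,n)-p_{1_{\tilde u_1}}(\ell_1,\dots,\ell_r;k,m,n)=p_{0_{u_1}}(\ell_1-1,\dots,\ell_r-1;k,m-1,n-(m-1)r)$$ $$\qquad+\,p_{0_{u_1}}(\ell_1-1,\dots,\ell_r-1;k-1,m-1,n-(m-1)(r-1)),$$ and $$p_{1_{\tilde u_1}}(\ell_1,\dots,\ell_r;k,m,n)=p_{0_{\tilde u_1}}(\ell_1,\dots,\ell_r;k,m,n-m).$$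
   Context: Primary colours $u_1<\dots<u_r$; for $1\le i\le2^r-1$ with binary digits $\epsilon_k(i)$ ($i=\sum_k\epsilon_k(i)2^{k-1}$), $\tilde u_i=u_1^{\epsilon_1(i)}\cdots u_r^{\epsilon_r(i)}$ (so $u_k=\tilde u_{2^{k-1}}$); $w(\tilde u_i)$ = number of primary colours in $\tilde u_i$; $v(\tilde u_i)$, $z(\tilde u_i)$ its smallest and largest primary colour; $\delta(\tilde u_i,\tilde u_j)=1$ if $z(\tilde u_i)<v(\tilde u_j)$, else $0$. An $E$-overpartition of $n$ is a sequence $\lambda_1\ge\dots\ge\lambda_s$ of non-negative integers summing to $n$, each with a colour $c(\lambda_t)\in\{\tilde u_1,\dots,\tilde u_{2^r-1}\}$ and possibly overlined, with $\lambda_t-\lambda_{t+1}\ge w(c(\lambda_{t+1}))+\chi(\overline{\lambda_{t+1}})-1+\delta(c(\lambda_t),c(\lambda_{t+1}))$ for $1\le t<s$ ($\chi=1$ if overlined, else $0$). Coloured non-negative integers are totally ordered by $0_{\tilde u_1}<\dots<0_{\tilde u_{2^r-1}}<1_{\tilde u_1}<\dots<1_{\tilde u_{2^r-1}}<2_{\tilde u_1}<\cdots$. $p_{i_{\tilde u_j}}(\ell_1,\dots,\ell_r;k,m,n)$ is the number of $E$-overpartitions of $n$ with exactly $m$ parts, exactly $k$ non-overlined parts, exactly $\ell_i$ parts having $u_i$ as a primary colour for each $i$, and smallest part (as a coloured integer) at least $i_{\tilde u_j}$; it is $0$ when any argument is negative. -}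

module Defs where

open import Data.Nat as ℕ using (ℕ; zero; suc; _+_; _*_; _∸_; _^_; _≤_; _<_; _/_; _%_)
open import Data.Nat.Properties as ℕP using ()
open import Data.Integer as ℤ using (ℤ; +_)
open import Data.Integer.Properties as ℤP using ()
open import Data.Bool using (Bool; true; false; not; if_then_else_)
open import Data.Nat.ListAction using (sum)
open import Data.List using (List; []; _∷_; length; map; upTo; reverse; takeWhile; filter; concatMap)
open import Data.List.Relation.Unary.All using (All; all?)
open import Data.List.Relation.Unary.Linked using (Linked; linked?)
open import Data.Fin using (Fin; toℕ)
open import Data.Fin.Properties as FinP using ()
open import Data.Product using (_×_; _,_)
open import Data.Sum using (_⊎_)
open import Relation.Binary.PropositionalEquality using (_≡_)
open import Relation.Nullary using (Dec; yes; no; does)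
open import Relation.Nullary.Decidable using (_×-dec_; _⊎-dec_)

-- The colour ũ_i (1 ≤ i ≤ 2^r - 1) is represented by its index i.
-- Primary colours are indexed 0-based: the paper's u_k (1 ≤ k ≤ r) is our
-- q = k - 1, and u_k = ũ_{2^(k-1)} is the colour index 2 ^ q.

-- ε : the paper's ε_{q+1}(i), i.e. the binary digit of i at position q (0-based)
ε : ℕ → ℕ → ℕ
ε i zero    = i % 2
ε i (suc q) = ε (i / 2) q

w : ℕ → ℕ → ℕ
w r i = sum (map (ε i) (upTo r))

-- v(ũ_i) : (0-based) index of the smallest primary colour of ũ_i
v : ℕ → ℕ → ℕ
v r i = length (takeWhile (λ q → ε i q ℕ.≟ 0) (upTo r))

-- z(ũ_i) : (0-based) index of the largest primary colour of ũ_i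
z : ℕ → ℕ → ℕ
z r i = r ∸ 1 ∸ length (takeWhile (λ q → ε i q ℕ.≟ 0) (reverse (upTo r)))

δ : ℕ → ℕ → ℕ → ℕ
δ r i j = if does (z r i ℕ.<? v r j) then 1 else 0

ValidCol : ℕ → ℕ → Set
ValidCol r i = 1 ≤ i × i < 2 ^ r

record Part : Set where
  constructor part
  field
    value : ℕ
    col   : ℕ
    over  : Bool
open Part public

χ : Part → ℕ
χ p = if over p then 1 else 0

-- difference condition between consecutive parts λ_t (= p) and λ_{t+1} (= q):
--   λ_t ≥ λ_{t+1}  and  λ_t - λ_{t+1} ≥ w(c(λ_{t+1})) + χ(λ_{t+1}) - 1 + δ(c(λ_t), c(λ_{t+1}))
-- (for valid colours w ≥ 1, so the right-hand side is a natural number)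
DiffCond : ℕ → Part → Part → Set
DiffCond r p q = value q ≤ value p × value q + (w r (col q) ∸ 1) + χ q + δ r (col p) (col q) ≤ value p

-- E-overpartition (as a list λ_1, ..., λ_s, largest first); its size is sum (map value λ)
IsEOverpartition : ℕ → List Part → Set
IsEOverpartition r λs = All (λ p → ValidCol r (col p)) λs × Linked (DiffCond r) λs

_≤c_ : ℕ × ℕ → ℕ × ℕ → Set
(a , c) ≤c (b , d) = a < b ⊎ (a ≡ b × c ≤ d)

-- smallest part (as coloured integer) is at least (a)_{ũ_c}
-- (the minimum of the parts is ≥ bound iff every part is ≥ bound)
SmallestAtLeast : ℕ → ℕ → List Part → Set
SmallestAtLeast a c λs = All (λ p → (a , c) ≤c (value p , col p)) λs

nonOverlined : List Part → ℕ
nonOverlined []       = 0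
nonOverlined (p ∷ ps) = (if over p then 0 else 1) + nonOverlined ps

withPrimary : ℕ → List Part → ℕ
withPrimary q []       = 0
withPrimary q (p ∷ ps) = ε (col p) q + withPrimary q ps

size : List Part → ℕ
size λs = sum (map value λs)

-- Integers are compared in ℤ, so negative arguments give no objects (count 0).
Counted : (r a c : ℕ) → (Fin r → ℤ) → ℤ → ℤ → ℤ → List Part → Set
Counted r a c ℓ k m n λs =
  IsEOverpartition r λs × SmallestAtLeast a c λs ×
  (+ length λs ≡ m) × (+ nonOverlined λs ≡ k) × (+ size λs ≡ n) ×
  (∀ q → + withPrimary (toℕ q) λs ≡ ℓ q)

diff? : ∀ r p q → Dec (DiffCond r p q)
diff? r p q = (value q ℕ.≤? value p) ×-dec
              (value q + (w r (col q) ∸ 1) + χ q + δ r (col p) (col q) ℕ.≤? value p)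

counted? : ∀ r a c ℓ k m n λs → Dec (Counted r a c ℓ k m n λs)
counted? r a c ℓ k m n λs =
  ((all? (λ p → (1 ℕ.≤? col p) ×-dec (col p ℕ.<? 2 ^ r)) λs ×-dec linked? (diff? r) λs)
  ×-dec all? (λ p → (a ℕ.<? value p) ⊎-dec ((a ℕ.≟ value p) ×-dec (c ℕ.≤? col p))) λs
  ×-dec (+ length λs ℤ.≟ m) ×-dec (+ nonOverlined λs ℤ.≟ k) ×-dec (+ size λs ℤ.≟ n)
  ×-dec FinP.all? (λ q → + withPrimary (toℕ q) λs ℤ.≟ ℓ q))

-- Every E-overpartition
-- of n with s parts occurs exactly once among candidates r n s.

allParts : ℕ → ℕ → List Part
allParts r N =
  concatMap (λ a → concatMap (λ c → part a (suc c) true ∷ part a (suc c) false ∷ [])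
                              (upTo (2 ^ r ∸ 1)))
            (upTo (suc N))

listsOfLength : ∀ {A : Set} → List A → ℕ → List (List A)
listsOfLength xs zero    = [] ∷ []
listsOfLength xs (suc s) = concatMap (λ x → map (x ∷_) (listsOfLength xs s)) xs

candidates : ℕ → ℕ → ℕ → List (List Part)
candidates r N s = listsOfLength (allParts r N) s

p : (r a c : ℕ) → (Fin r → ℤ) → ℤ → ℤ → ℤ → ℕ
p r a c ℓ k m n =
  length (filter (counted? r a c ℓ k m n) (candidates r ℤ.∣ n ∣ ℤ.∣ m ∣))

-- In an E-overpartition consecutive parts decrease in the coloured order, so the last part is a
-- smallest one. An E-overpartition counted by p_{0_{ũ_j}} but not by p at the successor of 0_{ũ_j}
-- (0_{ũ_{j+1}}, or 1_{ũ_1} when j = 2^r − 1) therefore ends in the part 0_{ũ_j}, overlined or not.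
-- Removing that part and lowering every other part by the gap w(ũ_j) − 1 + χ that the difference
-- condition leaves above it is a bijection onto the E-overpartitions with one part fewer whose parts
-- are all at least 0_{v(ũ_j)}: against the removed part, a part a_c only has to satisfy δ(c, ũ_j) ≤ a,
-- and for a = 0 this says that the largest primary colour of c is not below v(ũ_j), i.e. c ≥ v(ũ_j)
-- as colour indices. Lowering every part by 1 likewise identifies p_{1_{ũ_1}} with p_{0_{ũ_1}} at size
-- n − m. Since p counts by filtering a duplicate-free list that contains every counted object, such
-- bijections give equalities of counts.

module Submission where

open import Defs
open import Data.Bool as Bool using (Bool; true; false; if_then_else_)
open import Data.Bool.Properties using (¬-not; not-¬)
open import Data.List using (List; []; _∷_; _++_; _∷ʳ_; [_]; length; map; filter; concatMap; upTo; applyUpTo; reverse; takeWhile; last; initLast; _∷ʳ′_)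
open import Data.List.Properties using (length-++; length-map; map-++; map-∘; map-id-local; ∷-injectiveˡ; ∷-injectiveʳ; ∷ʳ-injectiveˡ; map-injective; filter-≐; map-applyUpTo; upTo-∷ʳ; reverse-++)
open import Data.List.Membership.Propositional using (_∈_; find)
open import Data.List.Membership.Propositional.Properties using (∈-∃++; ∈-++⁻; ∈-++⁺ˡ; ∈-++⁺ʳ; ∈-filter⁺; ∈-filter⁻; ∈-map⁺; ∈-map⁻; ∈-concatMap⁺; ∈-concatMap⁻; ∈-upTo⁺)
open import Data.List.Relation.Binary.Subset.Propositional using (_⊆_)
open import Data.List.Relation.Unary.All as All using (All; []; _∷_)
import Data.List.Relation.Unary.All.Properties as All
open import Data.List.Relation.Unary.Any as Any using (here; there)
open import Data.List.Relation.Unary.AllPairs using ([]; _∷_)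
open import Data.List.Relation.Unary.Linked as Linked using (Linked; []; [-]; _∷_)
import Data.List.Relation.Unary.Linked.Properties as Linked
open import Data.List.Relation.Unary.Unique.Propositional using (Unique)
import Data.List.Relation.Unary.Unique.Propositional.Properties as Unique
open import Data.Nat as ℕ using (ℕ; zero; suc; _+_; _*_; _∸_; _^_; _/_; _%_; _≤_; _<_; z≤n; s≤s)
open import Data.Nat.DivMod using (m≡m%n+[m/n]*n; m%n<n; m<n*o⇒m/o<n; /-monoˡ-≤; [m+kn]%n≡m%n; +-distrib-/; m*n%n≡0; m*n/n≡m)
open import Data.Nat.ListAction using (sum)
open import Data.Nat.ListAction.Properties using (sum-++)
open import Data.Nat.Tactic.RingSolver using (solve-∀)
open import Data.Nat.Properties as ℕ using (≤-refl; ≤-trans; ≤-antisym; ≤-reflexive)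
open import Data.Integer as ℤ using (ℤ; +_; _-_)
open import Data.Integer.Properties as ℤ using ()
open import Algebra.Properties.AbelianGroup ℤ.+-0-abelianGroup using (//-rightDividesˡ; //-rightDividesʳ)
open import Data.Fin using (Fin; toℕ)
open import Data.Fin.Properties using (toℕ<n)
open import Data.Product using (_×_; _,_; proj₁; proj₂; ∃)
open import Data.Product.Properties using (≡-dec)
open import Data.Maybe using (just; maybe)
open import Data.Sum using (_⊎_; inj₁; inj₂)
open import Function using (id; _∘_; Injective; _⇔_; mk⇔; Equivalence)
open Equivalence using (to; from)
open import Relation.Binary.PropositionalEquality using (_≡_; _≢_; refl; sym; trans; cong; cong₂; subst; module ≡-Reasoning)
open import Relation.Nullary using (¬_; Dec; yes; no; does; contradiction)
open import Relation.Unary using (Decidable; _∩_; ∁)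
open import Relation.Unary.Properties using (_∩?_; ∁?)

module _ {A : Set} where

  ∈-++-∷⁻ : ∀ {x y : A} as {bs} → y ∈ as ++ x ∷ bs → y ≢ x → y ∈ as ++ bs
  ∈-++-∷⁻ as y∈ y≢x with ∈-++⁻ as y∈
  ... | inj₁ y∈as         = ∈-++⁺ˡ y∈as
  ... | inj₂ (here y≡x)   = contradiction y≡x y≢x
  ... | inj₂ (there y∈bs) = ∈-++⁺ʳ as y∈bs

  Unique∧⊆⇒length≤ : ∀ {xs ys : List A} → Unique xs → xs ⊆ ys → length xs ≤ length ys
  Unique∧⊆⇒length≤ {[]}     _              _     = z≤n
  Unique∧⊆⇒length≤ {x ∷ xs} (x∉xs ∷ uxs) xs⊆ys with ∈-∃++ (xs⊆ys (here refl))
  ... | as , bs , refl = begin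
    suc (length xs)             ≤⟨ s≤s (Unique∧⊆⇒length≤ uxs xs⊆as++bs) ⟩
    suc (length (as ++ bs))     ≡⟨ cong suc (length-++ as) ⟩
    suc (length as + length bs) ≡⟨ ℕ.+-suc (length as) (length bs) ⟨
    length as + length (x ∷ bs) ≡⟨ length-++ as ⟨
    length (as ++ x ∷ bs)       ∎
    where
    open ℕ.≤-Reasoning
    xs⊆as++bs : xs ⊆ as ++ bs
    xs⊆as++bs y∈xs = ∈-++-∷⁻ as (xs⊆ys (there y∈xs)) (λ y≡x → All.lookup x∉xs y∈xs (sym y≡x))

  Unique-concatMap⁺ : ∀ {B : Set} (f : A → List B) {xs} → Unique xs → (∀ x → Unique (f x)) →
    (∀ {x y b} → b ∈ f x → b ∈ f y → x ≡ y) → Unique (concatMap f xs)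
  Unique-concatMap⁺ f []                     _        _      = []
  Unique-concatMap⁺ f {x ∷ xs} (x∉xs ∷ uxs) unique-f fibres =
    Unique.++⁺ (unique-f x) (Unique-concatMap⁺ f uxs unique-f fibres) disjoint
    where
    disjoint : ∀ {b} → ¬ (b ∈ f x × b ∈ concatMap f xs)
    disjoint (b∈fx , b∈rest) with find (∈-concatMap⁻ f b∈rest)
    ... | y , y∈xs , b∈fy = All.lookup x∉xs y∈xs (fibres b∈fx b∈fy)

  module _ {P Q : A → Set} (P? : Decidable P) (Q? : Decidable Q) where

    length-filter-∩∁ : ∀ xs →
      length (filter P? xs) ≡ length (filter (P? ∩? Q?) xs) + length (filter (P? ∩? ∁? Q?) xs)
    length-filter-∩∁ []       = refl
    length-filter-∩∁ (x ∷ xs) with P? x | Q? x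
    ... | yes _ | yes _ = cong suc (length-filter-∩∁ xs)
    ... | yes _ | no  _ = trans (cong suc (length-filter-∩∁ xs)) (sym (ℕ.+-suc _ _))
    ... | no  _ | yes _ = length-filter-∩∁ xs
    ... | no  _ | no  _ = length-filter-∩∁ xs

module _ {A B : Set} {P : A → Set} {Q : B → Set} (P? : Decidable P) (Q? : Decidable Q)
         {xs : List A} {ys : List B} (unique-xs : Unique xs) (unique-ys : Unique ys)
         (P⊆xs : ∀ {x} → P x → x ∈ xs) (Q⊆ys : ∀ {y} → Q y → y ∈ ys)
         (f : B → A) (f-injective : Injective _≡_ _≡_ f)
         (f-resp : ∀ {y} → Q y → P (f y)) (f-onto : ∀ {x} → P x → ∃ λ y → Q y × f y ≡ x) where

  length-filter-bijection : length (filter P? xs) ≡ length (filter Q? ys)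
  length-filter-bijection = ≤-antisym
    (≤-trans (Unique∧⊆⇒length≤ (Unique.filter⁺ P? unique-xs) P-side⊆image)
             (≤-reflexive (length-map f (filter Q? ys))))
    (≤-trans (≤-reflexive (sym (length-map f (filter Q? ys))))
             (Unique∧⊆⇒length≤ (Unique.map⁺ f-injective (Unique.filter⁺ Q? unique-ys)) image⊆P-side))
    where
    P-side⊆image : filter P? xs ⊆ map f (filter Q? ys)
    P-side⊆image x∈ with f-onto (proj₂ (∈-filter⁻ P? {xs = xs} x∈))
    ... | y , qy , refl = ∈-map⁺ f (∈-filter⁺ Q? (Q⊆ys qy) qy)
    image⊆P-side : map f (filter Q? ys) ⊆ filter P? xs
    image⊆P-side x∈ with ∈-map⁻ f x∈
    ... | y , y∈ , refl =
      let qy = proj₂ (∈-filter⁻ Q? {xs = ys} y∈) in ∈-filter⁺ P? (P⊆xs (f-resp qy)) (f-resp qy)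

module _ {A : Set} {R : A → A → Set} where

  Linked-∷ʳ⁺ : ∀ {q} xs → Linked R xs → All (λ x → R x q) xs → Linked R (xs ∷ʳ q)
  Linked-∷ʳ⁺ []           _           _              = [-]
  Linked-∷ʳ⁺ (x ∷ [])     _           (rxq ∷ [])     = rxq ∷ [-]
  Linked-∷ʳ⁺ (x ∷ y ∷ xs) (rxy ∷ rxs) (_ ∷ ryq ∷ rs) = rxy ∷ Linked-∷ʳ⁺ (y ∷ xs) rxs (ryq ∷ rs)

module _ {A : Set} {P : A → Set} {R : A → A → Set} where

  Linked-map-on : ∀ {S : A → A → Set} → (∀ {x y} → P x → P y → R x y → S x y) →
    ∀ {xs} → All P xs → Linked R xs → Linked S xs
  Linked-map-on f _                []          = []
  Linked-map-on f _                [-]         = [-]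
  Linked-map-on f (px ∷ py ∷ pxs) (rxy ∷ rxs) = f px py rxy ∷ Linked-map-on f (py ∷ pxs) rxs

  Linked-∷ʳ⁻ : ∀ {q} → (∀ {x y} → P x → P y → R x y → R y q → R x q) →
    ∀ xs → All P xs → Linked R (xs ∷ʳ q) → Linked R xs × All (λ x → R x q) xs
  Linked-∷ʳ⁻ trans-q []           _              _            = [] , []
  Linked-∷ʳ⁻ trans-q (x ∷ [])     _              (rxq ∷ [-])  = [-] , rxq ∷ []
  Linked-∷ʳ⁻ trans-q (x ∷ y ∷ xs) (px ∷ py ∷ ps) (rxy ∷ rest) with Linked-∷ʳ⁻ trans-q (y ∷ xs) (py ∷ ps) rest
  ... | linked , ryq ∷ rs = rxy ∷ linked , trans-q px py rxy ryq ∷ ryq ∷ rs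

last-∷ʳ : ∀ {A : Set} (xs : List A) x → last (xs ∷ʳ x) ≡ just x
last-∷ʳ []           x = refl
last-∷ʳ (_ ∷ [])     x = refl
last-∷ʳ (_ ∷ y ∷ xs) x = last-∷ʳ (y ∷ xs) x

takeWhile-map : ∀ {A B : Set} {P : B → Set} (P? : Decidable P) (f : A → B) xs →
  takeWhile P? (map f xs) ≡ map f (takeWhile (P? ∘ f) xs)
takeWhile-map P? f []       = refl
takeWhile-map P? f (x ∷ xs) with does (P? (f x))
... | true  = cong (f x ∷_) (takeWhile-map P? f xs)
... | false = refl

module _ {A : Set} {P : A → Set} (P? : Decidable P) where

  takeWhile-accept : ∀ x xs → P x → takeWhile P? (x ∷ xs) ≡ x ∷ takeWhile P? xs
  takeWhile-accept x xs px with P? x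
  ... | yes _   = refl
  ... | no  ¬px = contradiction px ¬px

  takeWhile-reject : ∀ x xs → ¬ P x → takeWhile P? (x ∷ xs) ≡ []
  takeWhile-reject x xs ¬px with P? x
  ... | yes px = contradiction px ¬px
  ... | no  _  = refl

reverse-upTo-suc : ∀ n → reverse (upTo (suc n)) ≡ n ∷ reverse (upTo n)
reverse-upTo-suc n = trans (cong reverse (sym (upTo-∷ʳ n))) (reverse-++ (upTo n) [ n ])

-- Binary digits of colours

w-suc : ∀ r c → w (suc r) c ≡ c % 2 + w r (c / 2)
w-suc r c = cong (λ bits → c % 2 + sum bits)
  (trans (map-applyUpTo suc (ε c) r) (sym (map-applyUpTo id (ε (c / 2)) r)))

ε≟0 : ∀ c q → Dec (ε c q ≡ 0)
ε≟0 c q = ε c q ℕ.≟ 0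

v-suc-odd : ∀ r c → c % 2 ≢ 0 → v (suc r) c ≡ 0
v-suc-odd r c odd = cong length (takeWhile-reject (ε≟0 c) 0 (applyUpTo suc r) odd)

v-suc-even : ∀ r c → c % 2 ≡ 0 → v (suc r) c ≡ suc (v r (c / 2))
v-suc-even r c even = begin
  v (suc r) c
    ≡⟨ cong length (takeWhile-accept (ε≟0 c) 0 (applyUpTo suc r) even) ⟩
  suc (length (takeWhile (ε≟0 c) (applyUpTo suc r)))
    ≡⟨ cong (λ qs → suc (length (takeWhile (ε≟0 c) qs))) (map-applyUpTo id suc r) ⟨
  suc (length (takeWhile (ε≟0 c) (map suc (upTo r))))
    ≡⟨ cong (suc ∘ length) (takeWhile-map (ε≟0 c) suc (upTo r)) ⟩
  suc (length (map suc (takeWhile (ε≟0 (c / 2)) (upTo r))))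
    ≡⟨ cong suc (length-map suc (takeWhile (ε≟0 (c / 2)) (upTo r))) ⟩
  suc (v r (c / 2))
    ∎
  where open ≡-Reasoning

z-suc : ∀ r c → z (suc r) c ≡ r ∸ length (takeWhile (ε≟0 c) (r ∷ reverse (upTo r)))
z-suc r c = cong (λ qs → r ∸ length (takeWhile (ε≟0 c) qs)) (reverse-upTo-suc r)

z-suc-ε≡0 : ∀ r c → ε c r ≡ 0 → z (suc r) c ≡ z r c
z-suc-ε≡0 r c bit≡0 = trans (z-suc r c) (trans
  (cong (λ qs → r ∸ length qs) (takeWhile-accept (ε≟0 c) r (reverse (upTo r)) bit≡0))
  (sym (ℕ.∸-+-assoc r 1 (length (takeWhile (ε≟0 c) (reverse (upTo r)))))))

z-suc-ε≢0 : ∀ r c → ε c r ≢ 0 → z (suc r) c ≡ r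
z-suc-ε≢0 r c bit≢0 = trans (z-suc r c)
  (cong (λ qs → r ∸ length qs) (takeWhile-reject (ε≟0 c) r (reverse (upTo r)) bit≢0))

/2-< : ∀ {c} q → c < 2 ^ suc q → c / 2 < 2 ^ q
/2-< {c} q c<2^1+q = m<n*o⇒m/o<n (subst (c <_) (ℕ.*-comm 2 (2 ^ q)) c<2^1+q)

2^≤⇒2^≤/2 : ∀ {c} q → 2 ^ suc q ≤ c → 2 ^ q ≤ c / 2
2^≤⇒2^≤/2 {c} q 2^1+q≤c =
  subst (_≤ c / 2) (m*n/n≡m (2 ^ q) 2) (/-monoˡ-≤ 2 (subst (_≤ c) (ℕ.*-comm 2 (2 ^ q)) 2^1+q≤c))

ε-< : ∀ {c} q → c < 2 ^ q → ε c q ≡ 0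
ε-< {zero}  zero    _       = refl
ε-< {suc _} zero    (s≤s ())
ε-< {c}     (suc q) c<2^1+q = ε-< q (/2-< q c<2^1+q)

ε-top : ∀ {c} q → 2 ^ q ≤ c → c < 2 ^ suc q → ε c q ≡ 1
ε-top {suc zero}    zero    _       _              = refl
ε-top {suc (suc _)} zero    _       (s≤s (s≤s ()))
ε-top {c}           (suc q) 2^1+q≤c c<2^2+q        = ε-top q (2^≤⇒2^≤/2 q 2^1+q≤c) (/2-< (suc q) c<2^2+q)

2^≤⇔≤z : ∀ r {c} → ValidCol r c → ∀ b → 2 ^ b ≤ c ⇔ b ≤ z r c
2^≤⇔≤z zero    (1≤c , c<1) b = contradiction (ℕ.<-≤-trans c<1 1≤c) (ℕ.<-irrefl refl)
2^≤⇔≤z (suc r) {c} (1≤c , c<2^1+r) b with c ℕ.<? 2 ^ r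
... | yes c<2^r rewrite z-suc-ε≡0 r c (ε-< r c<2^r) = 2^≤⇔≤z r (1≤c , c<2^r) b
... | no  c≮2^r rewrite z-suc-ε≢0 r c (ℕ.1+n≢0 ∘ trans (sym (ε-top r (ℕ.≮⇒≥ c≮2^r) c<2^1+r))) =
  mk⇔ b≤r (λ b≤r → ≤-trans (ℕ.^-monoʳ-≤ 2 b≤r) 2^r≤c)
  where
  2^r≤c : 2 ^ r ≤ c
  2^r≤c = ℕ.≮⇒≥ c≮2^r
  b≤r : 2 ^ b ≤ c → b ≤ r
  b≤r 2^b≤c with b ℕ.≤? r
  ... | yes b≤r = b≤r
  ... | no  b≰r = contradiction (ℕ.<-≤-trans c<2^1+r (≤-trans (ℕ.^-monoʳ-≤ 2 (ℕ.≰⇒> b≰r)) 2^b≤c)) (ℕ.<-irrefl refl)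

c%2≡0⊎c%2≡1 : ∀ c → c % 2 ≡ 0 ⊎ c % 2 ≡ 1
c%2≡0⊎c%2≡1 c with c % 2 | m%n<n c 2
... | zero        | _              = inj₁ refl
... | suc zero    | _              = inj₂ refl
... | suc (suc _) | s≤s (s≤s ())

w≡0⇒c≡0 : ∀ r {c} → c < 2 ^ r → w r c ≡ 0 → c ≡ 0
w≡0⇒c≡0 zero    {zero}  _        _   = refl
w≡0⇒c≡0 zero    {suc _} (s≤s ()) _
w≡0⇒c≡0 (suc r) {c} c<2^1+r w≡0 = begin
  c                 ≡⟨ m≡m%n+[m/n]*n c 2 ⟩
  c % 2 + c / 2 * 2 ≡⟨ cong₂ (λ b h → b + h * 2) (ℕ.m+n≡0⇒m≡0 (c % 2) bits≡0) half≡0 ⟩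
  0                 ∎
  where
  open ≡-Reasoning
  bits≡0 : c % 2 + w r (c / 2) ≡ 0
  bits≡0 = trans (sym (w-suc r c)) w≡0
  half≡0 : c / 2 ≡ 0
  half≡0 = w≡0⇒c≡0 r (/2-< r c<2^1+r) (ℕ.m+n≡0⇒n≡0 (c % 2) bits≡0)

1≤w : ∀ r {c} → ValidCol r c → 1 ≤ w r c
1≤w r {c} (1≤c , c<2^r) with w r c in w≡
... | zero  = contradiction (w≡0⇒c≡0 r c<2^r w≡) (ℕ.m<n⇒n≢0 1≤c)
... | suc _ = s≤s z≤n

w≡1⇒c≡2^v : ∀ r {c} → ValidCol r c → w r c ≡ 1 → c ≡ 2 ^ v r c
w≡1⇒c≡2^v zero    (1≤c , c<1) _ = contradiction (ℕ.<-≤-trans c<1 1≤c) (ℕ.<-irrefl refl)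
w≡1⇒c≡2^v (suc r) {c} (1≤c , c<2^1+r) w≡1 with c%2≡0⊎c%2≡1 c
... | inj₂ odd = begin
  c                 ≡⟨ m≡m%n+[m/n]*n c 2 ⟩
  c % 2 + c / 2 * 2 ≡⟨ cong₂ (λ b h → b + h * 2) odd half≡0 ⟩
  2 ^ 0             ≡⟨ cong (2 ^_) (v-suc-odd r c (ℕ.1+n≢0 ∘ trans (sym odd))) ⟨
  2 ^ v (suc r) c   ∎
  where
  open ≡-Reasoning
  half≡0 : c / 2 ≡ 0
  half≡0 = w≡0⇒c≡0 r (/2-< r c<2^1+r)
    (ℕ.suc-injective (trans (cong (_+ w r (c / 2)) (sym odd)) (trans (sym (w-suc r c)) w≡1)))
... | inj₁ even = begin
  c                     ≡⟨ m≡m%n+[m/n]*n c 2 ⟩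
  c % 2 + c / 2 * 2     ≡⟨ cong (_+ c / 2 * 2) even ⟩
  c / 2 * 2             ≡⟨ cong (_* 2) (w≡1⇒c≡2^v r (1≤c/2 , /2-< r c<2^1+r) half-w≡1) ⟩
  2 ^ v r (c / 2) * 2   ≡⟨ ℕ.*-comm (2 ^ v r (c / 2)) 2 ⟩
  2 ^ suc (v r (c / 2)) ≡⟨ cong (2 ^_) (v-suc-even r c even) ⟨
  2 ^ v (suc r) c       ∎
  where
  open ≡-Reasoning
  half-w≡1 : w r (c / 2) ≡ 1
  half-w≡1 = trans (cong (_+ w r (c / 2)) (sym even)) (trans (sym (w-suc r c)) w≡1)
  1≤c/2 : 1 ≤ c / 2
  1≤c/2 = ℕ.n≢0⇒n>0 λ half≡0 → ℕ.m<n⇒n≢0 1≤c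
    (trans (m≡m%n+[m/n]*n c 2) (cong₂ (λ b h → b + h * 2) even half≡0))

allOnes-suc : ∀ r → 2 ^ suc r ∸ 1 ≡ 1 + (2 ^ r ∸ 1) * 2
allOnes-suc r = go (2 ^ r) (ℕ.m^n>0 2 r)
  where
  go : ∀ x → 1 ≤ x → 2 * x ∸ 1 ≡ 1 + (x ∸ 1) * 2
  go (suc a) _ = trans (ℕ.+-suc a (a + 0)) (cong suc (ℕ.*-comm 2 a))

allOnes-%2 : ∀ r → (2 ^ suc r ∸ 1) % 2 ≡ 1
allOnes-%2 r = trans (cong (_% 2) (allOnes-suc r)) ([m+kn]%n≡m%n 1 (2 ^ r ∸ 1) 2)

allOnes-/2 : ∀ r → (2 ^ suc r ∸ 1) / 2 ≡ 2 ^ r ∸ 1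
allOnes-/2 r = trans (cong (_/ 2) (allOnes-suc r))
  (trans (+-distrib-/ 1 (h * 2) (subst (λ t → 1 + t < 2) (sym (m*n%n≡0 h 2)) ≤-refl)) (m*n/n≡m h 2))
  where
  h : ℕ
  h = 2 ^ r ∸ 1

2^r∸1<2^r : ∀ r → 2 ^ r ∸ 1 < 2 ^ r
2^r∸1<2^r r = ℕ.∸-monoʳ-< {m = 2 ^ r} {n = 1} (s≤s z≤n) (ℕ.m^n>0 2 r)

allOnes-valid : ∀ r → ValidCol (suc r) (2 ^ suc r ∸ 1)
allOnes-valid r = subst (1 ≤_) (sym (allOnes-suc r)) (s≤s z≤n) , 2^r∸1<2^r (suc r)

ε-allOnes : ∀ r q → q < r → ε (2 ^ r ∸ 1) q ≡ 1
ε-allOnes (suc r) zero    _         = allOnes-%2 r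
ε-allOnes (suc r) (suc q) (s≤s q<r) = trans (cong (λ h → ε h q) (allOnes-/2 r)) (ε-allOnes r q q<r)

w-allOnes : ∀ r → w r (2 ^ r ∸ 1) ≡ r
w-allOnes zero    = refl
w-allOnes (suc r) = trans (w-suc r _) (cong₂ _+_ (allOnes-%2 r) (trans (cong (w r) (allOnes-/2 r)) (w-allOnes r)))

v-allOnes : ∀ r → v (suc r) (2 ^ suc r ∸ 1) ≡ 0
v-allOnes r = v-suc-odd r (2 ^ suc r ∸ 1) (ℕ.1+n≢0 ∘ trans (sym (allOnes-%2 r)))

coloured : Part → ℕ × ℕ
coloured x = value x , col x

≤c-refl : ∀ {x} → x ≤c x
≤c-refl = inj₂ (refl , ≤-refl)

≤c-trans : ∀ {x y z} → x ≤c y → y ≤c z → x ≤c z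
≤c-trans (inj₁ a<b)         (inj₁ b<c)         = inj₁ (ℕ.<-trans a<b b<c)
≤c-trans (inj₁ a<b)         (inj₂ (refl , _))  = inj₁ a<b
≤c-trans (inj₂ (refl , _))  (inj₁ b<c)         = inj₁ b<c
≤c-trans (inj₂ (refl , c≤d)) (inj₂ (refl , d≤e)) = inj₂ (refl , ≤-trans c≤d d≤e)

≤c-+ʳ : ∀ d {a b c c′} → (a + d , c) ≤c (b + d , c′) ⇔ (a , c) ≤c (b , c′)
≤c-+ʳ d {a} {b} = mk⇔
  (λ { (inj₁ a+d<b+d)         → inj₁ (ℕ.+-cancelʳ-< d a b a+d<b+d)
     ; (inj₂ (a+d≡b+d , c≤c′)) → inj₂ (ℕ.+-cancelʳ-≡ d a b a+d≡b+d , c≤c′) })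
  (λ { (inj₁ a<b)         → inj₁ (ℕ.+-monoˡ-< d a<b)
     ; (inj₂ (refl , c≤c′)) → inj₂ (refl , c≤c′) })

0₁≤c : ∀ r {x} → ValidCol r (col x) → (0 , 1) ≤c coloured x
0₁≤c r {part zero    c o} (1≤c , _) = inj₂ (refl , 1≤c)
0₁≤c r {part (suc a) c o} _         = inj₁ (s≤s z≤n)

m+n≤m⇒n≡0 : ∀ m {n} → m + n ≤ m → n ≡ 0
m+n≤m⇒n≡0 m {n} m+n≤m = ℕ.n≤0⇒n≡0 (ℕ.+-cancelˡ-≤ m n 0 (subst (m + n ≤_) (sym (ℕ.+-identityʳ m)) m+n≤m))

δ≡0⇔v≤z : ∀ r c c′ → δ r c c′ ≡ 0 ⇔ v r c′ ≤ z r c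
δ≡0⇔v≤z r c c′ = indicator (z r c ℕ.<? v r c′)
  where
  indicator : (z<v? : Dec (z r c < v r c′)) → (if does z<v? then 1 else 0) ≡ 0 ⇔ v r c′ ≤ z r c
  indicator (yes z<v) = mk⇔ (λ ()) (λ v≤z → contradiction v≤z (ℕ.<⇒≱ z<v))
  indicator (no  z≮v) = mk⇔ (λ _ → ℕ.≮⇒≥ z≮v) (λ _ → refl)

δ≤1 : ∀ r c c′ → δ r c c′ ≤ 1
δ≤1 r c c′ with does (z r c ℕ.<? v r c′)
... | true  = ≤-refl
... | false = z≤n

-- Equal values force w(col y) = 1 and δ = 0: col y is a single primary colour, not above the
-- largest primary colour of col x.
DiffCond⇒≤c : ∀ r {x y} → ValidCol r (col x) → ValidCol r (col y) → DiffCond r x y → coloured y ≤c coloured x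
DiffCond⇒≤c r {x} {y} valid-x valid-y (y≤x , bound) with ℕ.m≤n⇒m<n∨m≡n y≤x
... | inj₁ y<x = inj₁ y<x
... | inj₂ y≡x = inj₂ (y≡x , col-y≤col-x)
  where
  W : ℕ
  W = w r (col y) ∸ 1
  excess≡0 : W + χ y + δ r (col x) (col y) ≡ 0
  excess≡0 = m+n≤m⇒n≡0 (value y) (subst (_≤ value y) (reassoc (value y) W (χ y) (δ r (col x) (col y)))
                                      (subst (value y + W + χ y + δ r (col x) (col y) ≤_) (sym y≡x) bound))
    where
    reassoc : ∀ a b c d → a + b + c + d ≡ a + (b + c + d)
    reassoc = solve-∀
  w≡1 : w r (col y) ≡ 1
  w≡1 = ≤-antisym (ℕ.m∸n≡0⇒m≤n (ℕ.m+n≡0⇒m≡0 W (ℕ.m+n≡0⇒m≡0 (W + χ y) excess≡0))) (1≤w r valid-y)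
  col-y≤col-x : col y ≤ col x
  col-y≤col-x = begin
    col y           ≡⟨ w≡1⇒c≡2^v r valid-y w≡1 ⟩
    2 ^ v r (col y) ≤⟨ from (2^≤⇔≤z r valid-x (v r (col y)))
                            (to (δ≡0⇔v≤z r (col x) (col y)) (ℕ.m+n≡0⇒n≡0 (W + χ y) excess≡0)) ⟩
    col x           ∎
    where open ℕ.≤-Reasoning

raise : ℕ → Part → Part
raise d x = part (value x + d) (col x) (over x)

lower : ℕ → Part → Part
lower d x = part (value x ∸ d) (col x) (over x)

lower-raise : ∀ d x → lower d (raise d x) ≡ x
lower-raise d x = cong (λ a → part a (col x) (over x)) (ℕ.m+n∸n≡m (value x) d)

raise-injective : ∀ d → Injective _≡_ _≡_ (raise d)
raise-injective d {x} {y} eq = begin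
  x                  ≡⟨ lower-raise d x ⟨
  lower d (raise d x) ≡⟨ cong (lower d) eq ⟩
  lower d (raise d y) ≡⟨ lower-raise d y ⟩
  y                  ∎
  where open ≡-Reasoning

map-raise-lower : ∀ d {xs} → All (λ x → d ≤ value x) xs → map (raise d) (map (lower d) xs) ≡ xs
map-raise-lower d {xs} d≤xs = trans (sym (map-∘ xs))
  (map-id-local (All.map (λ d≤x → cong (λ a → part a _ _) (ℕ.m∸n+n≡m d≤x)) d≤xs))

DiffCond-raise : ∀ r d {x y} → DiffCond r (raise d x) (raise d y) ⇔ DiffCond r x y
DiffCond-raise r d {x} {y} = mk⇔
  (λ (y≤x , bound) → ℕ.+-cancelʳ-≤ d _ _ y≤x , ℕ.+-cancelʳ-≤ d _ _ (subst (_≤ value x + d) shift bound))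
  (λ (y≤x , bound) → ℕ.+-monoˡ-≤ d y≤x , subst (_≤ value x + d) (sym shift) (ℕ.+-monoˡ-≤ d bound))
  where
  move : ∀ a d b c e → a + d + b + c + e ≡ a + b + c + e + d
  move = solve-∀
  shift : value y + d + (w r (col y) ∸ 1) + χ y + δ r (col x) (col y)
        ≡ value y + (w r (col y) ∸ 1) + χ y + δ r (col x) (col y) + d
  shift = move (value y) d (w r (col y) ∸ 1) (χ y) (δ r (col x) (col y))

Linked-raise : ∀ r d {xs} → Linked (DiffCond r) (map (raise d) xs) ⇔ Linked (DiffCond r) xs
Linked-raise r d {xs} = mk⇔
  (λ linked → Linked.map (λ {x} {y} → to (DiffCond-raise r d {x} {y})) (Linked.map⁻ {f = raise d} {xs = xs} linked))
  (λ linked → Linked.map⁺ {f = raise d} (Linked.map (λ {x} {y} → from (DiffCond-raise r d {x} {y})) linked))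

raise-IsEOverpartition : ∀ r d {xs} → IsEOverpartition r (map (raise d) xs) ⇔ IsEOverpartition r xs
raise-IsEOverpartition r d = mk⇔ (λ (valid , linked) → All.map⁻ valid , to (Linked-raise r d) linked)
                                 (λ (valid , linked) → All.map⁺ valid , from (Linked-raise r d) linked)

smallestAtLeast-∷ʳ : ∀ r {a c ys q} → IsEOverpartition r (ys ∷ʳ q) → (a , c) ≤c coloured q →
  SmallestAtLeast a c (ys ∷ʳ q)
smallestAtLeast-∷ʳ r {ys = ys} {q} (valid , linked) a≤q =
  All.∷ʳ⁺ (All.map (≤c-trans a≤q) q≤ys) a≤q
  where
  q≤ys : All (λ y → coloured q ≤c coloured y) ys
  q≤ys = proj₂ (Linked-∷ʳ⁻ (λ _ _ y≤x q≤y → ≤c-trans q≤y y≤x) ys (proj₁ (All.∷ʳ⁻ valid))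
                           (Linked-map-on (λ {x} {y} → DiffCond⇒≤c r {x} {y}) valid linked))

nonOverlined-++ : ∀ xs ys → nonOverlined (xs ++ ys) ≡ nonOverlined xs + nonOverlined ys
nonOverlined-++ []       ys = refl
nonOverlined-++ (x ∷ xs) ys = trans (cong (_+_ (if over x then 0 else 1)) (nonOverlined-++ xs ys))
                                     (sym (ℕ.+-assoc (if over x then 0 else 1) _ _))

withPrimary-++ : ∀ q xs ys → withPrimary q (xs ++ ys) ≡ withPrimary q xs + withPrimary q ys
withPrimary-++ q []       ys = refl
withPrimary-++ q (x ∷ xs) ys = trans (cong (_+_ (ε (col x) q)) (withPrimary-++ q xs ys))
                                      (sym (ℕ.+-assoc (ε (col x) q) _ _))

size-++ : ∀ xs ys → size (xs ++ ys) ≡ size xs + size ys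
size-++ xs ys = trans (cong sum (map-++ value xs ys)) (sum-++ (map value xs) (map value ys))

nonOverlined-raise : ∀ d xs → nonOverlined (map (raise d) xs) ≡ nonOverlined xs
nonOverlined-raise d []       = refl
nonOverlined-raise d (x ∷ xs) = cong (_+_ (if over x then 0 else 1)) (nonOverlined-raise d xs)

withPrimary-raise : ∀ q d xs → withPrimary q (map (raise d) xs) ≡ withPrimary q xs
withPrimary-raise q d []       = refl
withPrimary-raise q d (x ∷ xs) = cong (_+_ (ε (col x) q)) (withPrimary-raise q d xs)

size-raise : ∀ d xs → size (map (raise d) xs) ≡ size xs + length xs * d
size-raise d []       = refl
size-raise d (x ∷ xs) = trans (cong (_+_ (value x + d)) (size-raise d xs)) (regroup (value x) d (size xs) (length xs))
  where
  regroup : ∀ a d s l → a + d + (s + l * d) ≡ a + s + (1 + l) * d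
  regroup = solve-∀

-- Counting by bijections

+≡⇔+≡- : ∀ {s a b i} → s ≡ a + b → + s ≡ i ⇔ + a ≡ i - + b
+≡⇔+≡- {a = a} {b} {i} refl = mk⇔
  (λ { refl → trans (sym (//-rightDividesʳ (+ b) (+ a))) (cong (_- + b) (sym (ℤ.pos-+ a b))) })
  (λ +a≡i-b → trans (ℤ.pos-+ a b) (trans (cong (ℤ._+ + b) +a≡i-b) (//-rightDividesˡ (+ b) i)))

overlinePair : ℕ → ℕ → List Part
overlinePair a c = part a (suc c) true ∷ part a (suc c) false ∷ []

∈-overlinePair : ∀ {a c x} → x ∈ overlinePair a c → value x ≡ a × col x ≡ suc c
∈-overlinePair (here refl)         = refl , refl
∈-overlinePair (there (here refl)) = refl , refl

allParts-unique : ∀ r N → Unique (allParts r N)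
allParts-unique r N =
  Unique-concatMap⁺ partsOfValue (Unique.upTo⁺ (suc N)) partsOfValue-unique
    (λ x∈a x∈b → trans (sym (value-∈ x∈a)) (value-∈ x∈b))
  where
  partsOfValue : ℕ → List Part
  partsOfValue a = concatMap (overlinePair a) (upTo (2 ^ r ∸ 1))
  value-∈ : ∀ {a x} → x ∈ partsOfValue a → value x ≡ a
  value-∈ {a} x∈ with find (∈-concatMap⁻ (overlinePair a) {xs = upTo (2 ^ r ∸ 1)} x∈)
  ... | _ , _ , x∈pair = proj₁ (∈-overlinePair x∈pair)
  partsOfValue-unique : ∀ a → Unique (partsOfValue a)
  partsOfValue-unique a = Unique-concatMap⁺ (overlinePair a) (Unique.upTo⁺ (2 ^ r ∸ 1))
    (λ _ → ((λ ()) ∷ []) ∷ [] ∷ [])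
    (λ x∈c x∈c′ → ℕ.suc-injective (trans (sym (proj₂ (∈-overlinePair x∈c))) (proj₂ (∈-overlinePair x∈c′))))

∈-allParts : ∀ r N {x} → value x ≤ N → ValidCol r (col x) → x ∈ allParts r N
∈-allParts r N {part a zero    o} _   (() , _)
∈-allParts r N {part a (suc c) o} a≤N (_ , 1+c<2^r) =
  ∈-concatMap⁺ _ (Any.map (λ { refl → ∈-concatMap⁺ (overlinePair a) (Any.map (λ { refl → ∈-pair o }) c∈) })
                          (∈-upTo⁺ (s≤s a≤N)))
  where
  c∈ : c ∈ upTo (2 ^ r ∸ 1)
  c∈ = ∈-upTo⁺ (ℕ.<⇒≤pred 1+c<2^r)
  ∈-pair : ∀ o → part a (suc c) o ∈ overlinePair a c
  ∈-pair true  = here refl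
  ∈-pair false = there (here refl)

module _ {A : Set} {xs : List A} where

  listsOfLength-unique : Unique xs → ∀ s → Unique (listsOfLength xs s)
  listsOfLength-unique unique-xs zero    = [] ∷ []
  listsOfLength-unique unique-xs (suc s) =
    Unique-concatMap⁺ (λ x → map (x ∷_) (listsOfLength xs s)) unique-xs
      (λ _ → Unique.map⁺ ∷-injectiveʳ (listsOfLength-unique unique-xs s))
      head-≡
    where
    head-≡ : ∀ {x y ys} → ys ∈ map (x ∷_) (listsOfLength xs s) → ys ∈ map (y ∷_) (listsOfLength xs s) → x ≡ y
    head-≡ {x} {y} ys∈x ys∈y with ∈-map⁻ (x ∷_) ys∈x | ∈-map⁻ (y ∷_) ys∈y
    ... | _ , _ , refl | _ , _ , eq = ∷-injectiveˡ eq

  ∈-listsOfLength : ∀ {ys} → All (_∈ xs) ys → ys ∈ listsOfLength xs (length ys)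
  ∈-listsOfLength []                  = here refl
  ∈-listsOfLength {y ∷ ys} (y∈xs ∷ ys⊆xs) =
    ∈-concatMap⁺ (λ x → map (x ∷_) (listsOfLength xs (length ys)))
      (Any.map (λ { refl → ∈-map⁺ (y ∷_) (∈-listsOfLength ys⊆xs) }) y∈xs)

candidates-unique : ∀ r N s → Unique (candidates r N s)
candidates-unique r N s = listsOfLength-unique (allParts-unique r N) s

value≤size : ∀ xs → All (λ x → value x ≤ size xs) xs
value≤size []       = []
value≤size (x ∷ xs) =
  ℕ.m≤m+n (value x) (size xs) ∷ All.map (λ v≤ → ≤-trans v≤ (ℕ.m≤n+m _ (value x))) (value≤size xs)

∈-candidates : ∀ {r a c ℓ k m n x} → Counted r a c ℓ k m n x → x ∈ candidates r ℤ.∣ n ∣ ℤ.∣ m ∣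
∈-candidates {r} {n = n} {x = x} ((valid , _) , _ , length≡ , _ , size≡ , _) =
  subst (λ s → x ∈ candidates r ℤ.∣ n ∣ s) (cong ℤ.∣_∣ length≡)
    (∈-listsOfLength (All.zipWith (λ (v≤ , vc) → ∈-allParts r ℤ.∣ n ∣ (subst (_ ≤_) (cong ℤ.∣_∣ size≡) v≤) vc)
                                  (value≤size x , valid)))

module _ {r a c ℓ k m n a′ c′ ℓ′ k′ m′ n′} {P : List Part → Set} (P? : Decidable P)
         (P⊆Counted : ∀ {x} → P x → Counted r a c ℓ k m n x)
         (f : List Part → List Part) (f-injective : Injective _≡_ _≡_ f)
         (f-resp : ∀ {y} → Counted r a′ c′ ℓ′ k′ m′ n′ y → P (f y))
         (f-onto : ∀ {x} → P x → ∃ λ y → Counted r a′ c′ ℓ′ k′ m′ n′ y × f y ≡ x) where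

  count-by-bijection : length (filter P? (candidates r ℤ.∣ n ∣ ℤ.∣ m ∣)) ≡ p r a′ c′ ℓ′ k′ m′ n′
  count-by-bijection = length-filter-bijection P? (counted? r a′ c′ ℓ′ k′ m′ n′)
    (candidates-unique r ℤ.∣ n ∣ ℤ.∣ m ∣) (candidates-unique r ℤ.∣ n′ ∣ ℤ.∣ m′ ∣)
    (∈-candidates ∘ P⊆Counted) ∈-candidates f f-injective f-resp f-onto

p-cong : ∀ r a {c c′ ℓ ℓ′ k k′} m {n n′} → c ≡ c′ → (∀ q → ℓ q ≡ ℓ′ q) → k ≡ k′ → n ≡ n′ →
  p r a c ℓ k m n ≡ p r a c′ ℓ′ k′ m n′
p-cong r a {c} {ℓ = ℓ} {ℓ′} {k} m {n} refl ℓ≗ℓ′ refl refl =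
  cong length (filter-≐ (counted? r a c ℓ k m n) (counted? r a c ℓ′ k m n)
                        (counted-ℓ ℓ≗ℓ′ , counted-ℓ (sym ∘ ℓ≗ℓ′)) (candidates r ℤ.∣ n ∣ ℤ.∣ m ∣))
  where
  counted-ℓ : ∀ {ℓ ℓ′ : Fin r → ℤ} → (∀ q → ℓ q ≡ ℓ′ q) →
    ∀ {x} → Counted r a c ℓ k m n x → Counted r a c ℓ′ k m n x
  counted-ℓ ℓ≗ℓ′ (e , s , len , nov , sz , prim) = e , s , len , nov , sz , λ q → trans (prim q) (ℓ≗ℓ′ q)

-- Removing a smallest part

-- as 0_{ũ_{j+1}} succeeds 0_{ũ_j}, and 1_{ũ_1} succeeds 0_{ũ_{2^r-1}}
Succeeds : ℕ → ℕ × ℕ → ℕ × ℕ → Set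
Succeeds r b a = ∀ {x} → ValidCol r (proj₂ x) → b ≤c x ⇔ (a ≤c x × x ≢ a)

Counted-rebound : ∀ {r a c a′ c′ ℓ k m n x} → SmallestAtLeast a′ c′ x →
  Counted r a c ℓ k m n x → Counted r a′ c′ ℓ k m n x
Counted-rebound smallest (e , _ , statistics) = e , smallest , statistics

part-≡ : ∀ {x a c o} → coloured x ≡ (a , c) → over x ≡ o → x ≡ part a c o
part-≡ refl refl = refl

-- (false on the empty list, which never carries a removable smallest part)
lastOverlined : List Part → Bool
lastOverlined xs = maybe over false (last xs)

lastOverlined-∷ʳ : ∀ xs x → lastOverlined (xs ∷ʳ x) ≡ over x
lastOverlined-∷ʳ xs x = cong (maybe over false) (last-∷ʳ xs x)

module RemoveSmallest (r j : ℕ) (j-valid : ValidCol r j) (o : Bool) where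

  bottom : Part
  bottom = part 0 j o

  -- the least gap the difference condition leaves above the bottom part: all other parts are lowered by it
  d : ℕ
  d = w r j ∸ 1 + χ bottom

  attach : List Part → List Part
  attach zs = map (raise d) zs ∷ʳ bottom

  DiffCond-bottom : ∀ {x} → ValidCol r (col x) → DiffCond r x bottom ⇔ (d , 2 ^ v r j) ≤c coloured x
  DiffCond-bottom {x} valid = mk⇔ ⇒ ⇐
    where
    δ′ : ℕ
    δ′ = δ r (col x) j
    ⇒ : DiffCond r x bottom → (d , 2 ^ v r j) ≤c coloured x
    ⇒ (_ , d+δ≤x) with ℕ.m≤n⇒m<n∨m≡n (ℕ.m+n≤o⇒m≤o d d+δ≤x)
    ... | inj₁ d<x = inj₁ d<x
    ... | inj₂ d≡x = inj₂ (d≡x , from (2^≤⇔≤z r valid (v r j))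
                                   (to (δ≡0⇔v≤z r (col x) j) (m+n≤m⇒n≡0 d (subst (d + δ′ ≤_) (sym d≡x) d+δ≤x))))
    ⇐ : (d , 2 ^ v r j) ≤c coloured x → DiffCond r x bottom
    ⇐ (inj₁ d<x)           =
      z≤n , ≤-trans (ℕ.+-monoʳ-≤ d (δ≤1 r (col x) j)) (subst (_≤ value x) (ℕ.+-comm 1 d) d<x)
    ⇐ (inj₂ (d≡x , 2^v≤c)) = z≤n , ≤-reflexive (begin
      d + δ′ ≡⟨ cong (_+_ d) (from (δ≡0⇔v≤z r (col x) j) (to (2^≤⇔≤z r valid (v r j)) 2^v≤c)) ⟩
      d + 0  ≡⟨ ℕ.+-identityʳ d ⟩
      d      ≡⟨ d≡x ⟩
      value x ∎)
      where open ≡-Reasoning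

  DiffCond-raise-bottom : ∀ {z} → ValidCol r (col z) →
    DiffCond r (raise d z) bottom ⇔ (0 , 2 ^ v r j) ≤c coloured z
  DiffCond-raise-bottom {z} valid = mk⇔ (to (≤c-+ʳ d) ∘ to (DiffCond-bottom {raise d z} valid))
                                        (from (DiffCond-bottom {raise d z} valid) ∘ from (≤c-+ʳ d))

  DiffCond-bottom-trans : ∀ {x y} → ValidCol r (col x) → ValidCol r (col y) →
    DiffCond r x y → DiffCond r y bottom → DiffCond r x bottom
  DiffCond-bottom-trans {x} {y} valid-x valid-y x≻y y≻bottom = from (DiffCond-bottom {x} valid-x)
    (≤c-trans (to (DiffCond-bottom {y} valid-y) y≻bottom) (DiffCond⇒≤c r {x} {y} valid-x valid-y x≻y))

  attach-IsEOverpartition : ∀ zs →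
    IsEOverpartition r (attach zs) ⇔ (IsEOverpartition r zs × SmallestAtLeast 0 (2 ^ v r j) zs)
  attach-IsEOverpartition zs = mk⇔ ⇒ ⇐
    where
    ⇒ : IsEOverpartition r (attach zs) → IsEOverpartition r zs × SmallestAtLeast 0 (2 ^ v r j) zs
    ⇒ (valid , linked) =
      let raised-valid = proj₁ (All.∷ʳ⁻ valid)
          zs-valid = All.map⁻ raised-valid
          (raised-linked , raised≻bottom) =
            Linked-∷ʳ⁻ (λ {x} {y} → DiffCond-bottom-trans {x} {y}) (map (raise d) zs) raised-valid linked
      in (zs-valid , to (Linked-raise r d) raised-linked) ,
         All.zipWith (λ {z} (valid-z , z≻bottom) → to (DiffCond-raise-bottom {z} valid-z) z≻bottom)
                     (zs-valid , All.map⁻ raised≻bottom)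
    ⇐ : IsEOverpartition r zs × SmallestAtLeast 0 (2 ^ v r j) zs → IsEOverpartition r (attach zs)
    ⇐ ((valid , linked) , smallest) =
      All.∷ʳ⁺ (All.map⁺ valid) j-valid ,
      Linked-∷ʳ⁺ (map (raise d) zs) (from (Linked-raise r d) linked)
        (All.map⁺ (All.zipWith (λ {z} (valid-z , z≥) → from (DiffCond-raise-bottom {z} valid-z) z≥)
                               (valid , smallest)))

  attach-injective : Injective _≡_ _≡_ attach
  attach-injective {zs} {zs′} eq =
    map-injective (raise-injective d) (∷ʳ-injectiveˡ (map (raise d) zs) (map (raise d) zs′) eq)

  ∷ʳ-bottom⇒attach : ∀ ys → IsEOverpartition r (ys ∷ʳ bottom) → attach (map (lower d) ys) ≡ ys ∷ʳ bottom
  ∷ʳ-bottom⇒attach ys (valid , linked) = cong (_∷ʳ bottom) (map-raise-lower d d≤ys)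
    where
    d≤ys : All (λ y → d ≤ value y) ys
    d≤ys = All.map (λ (_ , d+δ≤y) → ℕ.m+n≤o⇒m≤o d d+δ≤y)
                   (proj₂ (Linked-∷ʳ⁻ (λ {x} {y} → DiffCond-bottom-trans {x} {y}) ys (proj₁ (All.∷ʳ⁻ valid)) linked))

  length-attach : ∀ zs → length (attach zs) ≡ length zs + 1
  length-attach zs = trans (length-++ (map (raise d) zs)) (cong (_+ 1) (length-map (raise d) zs))

  nonOverlined-attach : ∀ zs → nonOverlined (attach zs) ≡ nonOverlined zs + nonOverlined [ bottom ]
  nonOverlined-attach zs = trans (nonOverlined-++ (map (raise d) zs) [ bottom ])
                                 (cong (_+ nonOverlined [ bottom ]) (nonOverlined-raise d zs))

  withPrimary-attach : ∀ q zs → withPrimary q (attach zs) ≡ withPrimary q zs + ε j q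
  withPrimary-attach q zs = trans (withPrimary-++ q (map (raise d) zs) [ bottom ])
                                  (cong₂ _+_ (withPrimary-raise q d zs) (ℕ.+-identityʳ (ε j q)))

  size-attach : ∀ zs → size (attach zs) ≡ size zs + length zs * d
  size-attach zs = trans (size-++ (map (raise d) zs) [ bottom ]) (trans (ℕ.+-identityʳ _) (size-raise d zs))

  module _ (ℓ : Fin r → ℤ) (k m n : ℤ) where

    ℓ⁻ : Fin r → ℤ
    ℓ⁻ q = ℓ q - + ε j (toℕ q)

    k⁻ m⁻ n⁻ : ℤ
    k⁻ = k - + nonOverlined [ bottom ]
    m⁻ = m - + 1
    n⁻ = n - m⁻ ℤ.* + d

    attach-Counted : ∀ zs → Counted r 0 j ℓ k m n (attach zs) ⇔ Counted r 0 (2 ^ v r j) ℓ⁻ k⁻ m⁻ n⁻ zs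
    attach-Counted zs = mk⇔ ⇒ ⇐
      where
      length*d : + length zs ≡ m⁻ → + (length zs * d) ≡ m⁻ ℤ.* + d
      length*d len = trans (ℤ.pos-* (length zs) d) (cong (ℤ._* + d) len)
      ⇒ : Counted r 0 j ℓ k m n (attach zs) → Counted r 0 (2 ^ v r j) ℓ⁻ k⁻ m⁻ n⁻ zs
      ⇒ (e , _ , len , nov , sz , prim) =
        let (e′ , s′) = to (attach-IsEOverpartition zs) e
            len′ = to (+≡⇔+≡- (length-attach zs)) len
        in e′ , s′ , len′ , to (+≡⇔+≡- (nonOverlined-attach zs)) nov ,
           trans (to (+≡⇔+≡- (size-attach zs)) sz) (cong (n -_) (length*d len′)) ,
           λ q → to (+≡⇔+≡- (withPrimary-attach (toℕ q) zs)) (prim q)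
      ⇐ : Counted r 0 (2 ^ v r j) ℓ⁻ k⁻ m⁻ n⁻ zs → Counted r 0 j ℓ k m n (attach zs)
      ⇐ (e′ , s′ , len′ , nov′ , sz′ , prim′) =
        let e = from (attach-IsEOverpartition zs) (e′ , s′)
        in e , smallestAtLeast-∷ʳ r e ≤c-refl , from (+≡⇔+≡- (length-attach zs)) len′ ,
           from (+≡⇔+≡- (nonOverlined-attach zs)) nov′ ,
           from (+≡⇔+≡- (size-attach zs)) (trans sz′ (cong (n -_) (sym (length*d len′)))) ,
           λ q → from (+≡⇔+≡- (withPrimary-attach (toℕ q) zs)) (prim′ q)

    module _ {a′ c′} (succeeds : Succeeds r (a′ , c′) (0 , j)) where

      Removable : List Part → Set
      Removable = (Counted r 0 j ℓ k m n ∩ ∁ (Counted r a′ c′ ℓ k m n)) ∩ (λ x → lastOverlined x ≡ o)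

      removable? : Decidable Removable
      removable? = (counted? r 0 j ℓ k m n ∩? ∁? (counted? r a′ c′ ℓ k m n)) ∩? (λ x → lastOverlined x Bool.≟ o)

      -- The last part is a smallest one; were it not 0_{ũ_j} itself, it would reach the successor.
      removable⇒∷ʳ-bottom : ∀ {x} → Removable x → ∃ λ ys → x ≡ ys ∷ʳ bottom
      removable⇒∷ʳ-bottom {x} ((counted , not-succ) , last≡o) with initLast x
      ... | []      = contradiction (Counted-rebound [] counted) not-succ
      ... | ys ∷ʳ′ q with ≡-dec ℕ._≟_ ℕ._≟_ (coloured q) (0 , j)
      ...   | yes q≡0j = ys , cong (ys ∷ʳ_) (part-≡ q≡0j (trans (sym (lastOverlined-∷ʳ ys q)) last≡o))
      ...   | no  q≢0j = contradiction (Counted-rebound (smallestAtLeast-∷ʳ r e succ≤q) counted) not-succ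
        where
        e : IsEOverpartition r (ys ∷ʳ q)
        e = proj₁ counted
        succ≤q : (a′ , c′) ≤c coloured q
        succ≤q = from (succeeds (proj₂ (All.∷ʳ⁻ (proj₁ e)))) (proj₂ (All.∷ʳ⁻ (proj₁ (proj₂ counted))) , q≢0j)

      removable-onto : ∀ {x} → Removable x → ∃ λ zs → Counted r 0 (2 ^ v r j) ℓ⁻ k⁻ m⁻ n⁻ zs × attach zs ≡ x
      removable-onto removable with removable⇒∷ʳ-bottom removable
      ... | ys , refl = map (lower d) ys , to (attach-Counted _) (subst (Counted r 0 j ℓ k m n) (sym eq) counted) , eq
        where
        counted : Counted r 0 j ℓ k m n (ys ∷ʳ bottom)
        counted = proj₁ (proj₁ removable)
        eq : attach (map (lower d) ys) ≡ ys ∷ʳ bottom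
        eq = ∷ʳ-bottom⇒attach ys (proj₁ counted)

      attach-removable : ∀ {zs} → Counted r 0 (2 ^ v r j) ℓ⁻ k⁻ m⁻ n⁻ zs → Removable (attach zs)
      attach-removable {zs} counted′ =
        (from (attach-Counted zs) counted′ , not-succ) , lastOverlined-∷ʳ (map (raise d) zs) bottom
        where
        not-succ : ¬ Counted r a′ c′ ℓ k m n (attach zs)
        not-succ (_ , smallest , _) = proj₂ (to (succeeds j-valid) (proj₂ (All.∷ʳ⁻ smallest))) refl

      count-removable : length (filter removable? (candidates r ℤ.∣ n ∣ ℤ.∣ m ∣)) ≡ p r 0 (2 ^ v r j) ℓ⁻ k⁻ m⁻ n⁻
      count-removable =
        count-by-bijection removable? (proj₁ ∘ proj₁) attach attach-injective attach-removable removable-onto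

p₀-difference : ∀ r {j a′ c′} → ValidCol r j → Succeeds r (a′ , c′) (0 , j) → ∀ ℓ k m n →
  + p r 0 j ℓ k m n - + p r a′ c′ ℓ k m n
    ≡ + p r 0 (2 ^ v r j) (λ q → ℓ q - + ε j (toℕ q)) k (m - + 1) (n - (m - + 1) ℤ.* + w r j)
      ℤ.+ + p r 0 (2 ^ v r j) (λ q → ℓ q - + ε j (toℕ q)) (k - + 1) (m - + 1) (n - (m - + 1) ℤ.* (+ w r j - + 1))
p₀-difference r {j} {a′} {c′} j-valid succeeds ℓ k m n = trans difference (cong₂ (λ x y → + x ℤ.+ + y) X≡ Y≡)
  where
  module T = RemoveSmallest r j j-valid true
  module F = RemoveSmallest r j j-valid false
  L : List (List Part)
  L = candidates r ℤ.∣ n ∣ ℤ.∣ m ∣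
  C? : Decidable (Counted r 0 j ℓ k m n)
  C? = counted? r 0 j ℓ k m n
  C′? : Decidable (Counted r a′ c′ ℓ k m n)
  C′? = counted? r a′ c′ ℓ k m n
  overlined? : Decidable (λ x → lastOverlined x ≡ true)
  overlined? x = lastOverlined x Bool.≟ true
  p′ X Y : ℕ
  p′ = p r a′ c′ ℓ k m n
  X = p r 0 (2 ^ v r j) (T.ℓ⁻ ℓ k m n) (T.k⁻ ℓ k m n) (T.m⁻ ℓ k m n) (T.n⁻ ℓ k m n)
  Y = p r 0 (2 ^ v r j) (F.ℓ⁻ ℓ k m n) (F.k⁻ ℓ k m n) (F.m⁻ ℓ k m n) (F.n⁻ ℓ k m n)

  C′⊆C : ∀ {x} → Counted r a′ c′ ℓ k m n x → Counted r 0 j ℓ k m n x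
  C′⊆C counted@((valid , _) , smallest , _) =
    Counted-rebound (All.zipWith (λ (v , s) → proj₁ (to (succeeds v) s)) (valid , smallest)) counted
  count-C∩C′ : length (filter (C? ∩? C′?) L) ≡ p′
  count-C∩C′ = cong length (filter-≐ (C? ∩? C′?) C′? (proj₂ , λ c′ → C′⊆C c′ , c′) L)
  count-C∖C′ : length (filter (C? ∩? ∁? C′?) L) ≡ X + Y
  count-C∖C′ = trans (length-filter-∩∁ (C? ∩? ∁? C′?) overlined? L) (cong₂ _+_
    (T.count-removable ℓ k m n succeeds)
    (trans (cong length (filter-≐ ((C? ∩? ∁? C′?) ∩? ∁? overlined?) (F.removable? ℓ k m n succeeds)
                                  ((λ (c , ≢true) → c , ¬-not ≢true) , (λ (c , ≡false) → c , not-¬ ≡false)) L))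
           (F.count-removable ℓ k m n succeeds)))
  split : p r 0 j ℓ k m n ≡ p′ + (X + Y)
  split = trans (length-filter-∩∁ C? C′? L) (cong₂ _+_ count-C∩C′ count-C∖C′)
  difference : + p r 0 j ℓ k m n - + p′ ≡ + X ℤ.+ + Y
  difference = begin
    + p r 0 j ℓ k m n - + p′   ≡⟨ cong (λ t → + t - + p′) split ⟩
    + (p′ + (X + Y)) - + p′    ≡⟨ to (+≡⇔+≡- (ℕ.+-comm p′ (X + Y))) refl ⟨
    + (X + Y)                  ≡⟨ ℤ.pos-+ X Y ⟩
    + X ℤ.+ + Y                ∎
    where open ≡-Reasoning

  1≤wj : 1 ≤ w r j
  1≤wj = 1≤w r j-valid
  X≡ : X ≡ p r 0 (2 ^ v r j) (λ q → ℓ q - + ε j (toℕ q)) k (m - + 1) (n - (m - + 1) ℤ.* + w r j)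
  X≡ = p-cong r 0 (m - + 1) refl (λ _ → refl) (ℤ.+-identityʳ k)
         (cong (λ e → n - (m - + 1) ℤ.* + e) (ℕ.m∸n+n≡m 1≤wj))
  Y≡ : Y ≡ p r 0 (2 ^ v r j) (λ q → ℓ q - + ε j (toℕ q)) (k - + 1) (m - + 1) (n - (m - + 1) ℤ.* (+ w r j - + 1))
  Y≡ = p-cong r 0 (m - + 1) refl (λ _ → refl) refl (cong (λ e → n - (m - + 1) ℤ.* e)
         (trans (cong +_ (ℕ.+-identityʳ (w r j ∸ 1))) (to (+≡⇔+≡- (sym (ℕ.m∸n+n≡m 1≤wj))) refl)))

succeeds-0-suc : ∀ r j → Succeeds r (0 , suc j) (0 , j)
succeeds-0-suc r j {a , c} _ = mk⇔ ⇒ ⇐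
  where
  ⇒ : (0 , suc j) ≤c (a , c) → (0 , j) ≤c (a , c) × (a , c) ≢ (0 , j)
  ⇒ (inj₁ 0<a)           = inj₁ 0<a , λ { refl → ℕ.<-irrefl refl 0<a }
  ⇒ (inj₂ (refl , j<c)) = inj₂ (refl , ℕ.<⇒≤ j<c) , λ { refl → ℕ.<-irrefl refl j<c }
  ⇐ : (0 , j) ≤c (a , c) × (a , c) ≢ (0 , j) → (0 , suc j) ≤c (a , c)
  ⇐ (inj₁ 0<a , _)          = inj₁ 0<a
  ⇐ (inj₂ (refl , j≤c) , ≢) = inj₂ (refl , ℕ.≤∧≢⇒< j≤c λ { refl → ≢ refl })

succeeds-top : ∀ r → Succeeds r (1 , 1) (0 , 2 ^ r ∸ 1)
succeeds-top r {a , c} (1≤c , c<2^r) = mk⇔ ⇒ ⇐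
  where
  ⇒ : (1 , 1) ≤c (a , c) → (0 , 2 ^ r ∸ 1) ≤c (a , c) × (a , c) ≢ (0 , 2 ^ r ∸ 1)
  ⇒ (inj₁ 1<a)        = inj₁ (ℕ.<-trans (s≤s z≤n) 1<a) , λ { refl → ℕ.n≮0 1<a }
  ⇒ (inj₂ (refl , _)) = inj₁ (s≤s z≤n) , λ ()
  ⇐ : (0 , 2 ^ r ∸ 1) ≤c (a , c) × (a , c) ≢ (0 , 2 ^ r ∸ 1) → (1 , 1) ≤c (a , c)
  ⇐ (inj₁ (s≤s {n = zero} _) , _)  = inj₂ (refl , 1≤c)
  ⇐ (inj₁ (s≤s {n = suc a} _) , _) = inj₁ (s≤s (s≤s z≤n))
  ⇐ (inj₂ (refl , top≤c) , ≢)     = contradiction (cong (0 ,_) (≤-antisym (ℕ.<⇒≤pred c<2^r) top≤c)) ≢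

-- Lowering every part

module _ {r : ℕ} (t : ℕ) (ℓ : Fin r → ℤ) (k m n : ℤ) where

  raise-Counted : ∀ zs → Counted r t 1 ℓ k m n (map (raise t) zs) ⇔ Counted r 0 1 ℓ k m (n - m ℤ.* + t) zs
  raise-Counted zs = mk⇔ ⇒ ⇐
    where
    length*t : + length zs ≡ m → + (length zs * t) ≡ m ℤ.* + t
    length*t len = trans (ℤ.pos-* (length zs) t) (cong (ℤ._* + t) len)
    ⇒ : Counted r t 1 ℓ k m n (map (raise t) zs) → Counted r 0 1 ℓ k m (n - m ℤ.* + t) zs
    ⇒ (e , _ , len , nov , sz , prim) =
      let e′ = to (raise-IsEOverpartition r t) e
          len′ = trans (cong +_ (sym (length-map (raise t) zs))) len
      in e′ , All.map (λ {z} → 0₁≤c r {z}) (proj₁ e′) , len′ ,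
         trans (cong +_ (sym (nonOverlined-raise t zs))) nov ,
         trans (to (+≡⇔+≡- (size-raise t zs)) sz) (cong (n -_) (length*t len′)) ,
         λ q → trans (cong +_ (sym (withPrimary-raise (toℕ q) t zs))) (prim q)
    ⇐ : Counted r 0 1 ℓ k m (n - m ℤ.* + t) zs → Counted r t 1 ℓ k m n (map (raise t) zs)
    ⇐ (e′ , _ , len′ , nov′ , sz′ , prim′) =
      from (raise-IsEOverpartition r t) e′ ,
      All.map⁺ (All.map (λ {z} valid → from (≤c-+ʳ t) (0₁≤c r {z} valid)) (proj₁ e′)) ,
      trans (cong +_ (length-map (raise t) zs)) len′ ,
      trans (cong +_ (nonOverlined-raise t zs)) nov′ ,
      from (+≡⇔+≡- (size-raise t zs)) (trans sz′ (cong (n -_) (sym (length*t len′)))) ,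
      λ q → trans (cong +_ (withPrimary-raise (toℕ q) t zs)) (prim′ q)

  p-lowest-shift : p r t 1 ℓ k m n ≡ p r 0 1 ℓ k m (n - m ℤ.* + t)
  p-lowest-shift = count-by-bijection (counted? r t 1 ℓ k m n) id (map (raise t)) (map-injective (raise-injective t))
    (λ {zs} → from (raise-Counted zs)) onto
    where
    onto : ∀ {x} → Counted r t 1 ℓ k m n x → ∃ λ zs → Counted r 0 1 ℓ k m (n - m ℤ.* + t) zs × map (raise t) zs ≡ x
    onto {x} counted@(_ , smallest , _) = map (lower t) x ,
      to (raise-Counted (map (lower t) x)) (subst (Counted r t 1 ℓ k m n) (sym x≡) counted) , x≡
      where
      x≡ : map (raise t) (map (lower t) x) ≡ x
      x≡ = map-raise-lower t (All.map (λ { (inj₁ t<x) → ℕ.<⇒≤ t<x ; (inj₂ (t≡x , _)) → ≤-reflexive t≡x }) smallest)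

lemma3p1 : (r : ℕ) → 1 ≤ r →
    ((j : ℕ) → 1 ≤ j → j ≤ 2 ^ r ∸ 2 → (ℓ : Fin r → ℤ) → (k m n : ℤ) →
      + p r 0 j ℓ k m n - + p r 0 (suc j) ℓ k m n
        ≡ + p r 0 (2 ^ v r j) (λ q → ℓ q - + ε j (toℕ q)) k (m - + 1) (n - (m - + 1) ℤ.* + w r j)
          ℤ.+ + p r 0 (2 ^ v r j) (λ q → ℓ q - + ε j (toℕ q)) (k - + 1) (m - + 1)
              (n - (m - + 1) ℤ.* (+ w r j - + 1)))
    × ((ℓ : Fin r → ℤ) → (k m n : ℤ) →
      + p r 0 (2 ^ r ∸ 1) ℓ k m n - + p r 1 1 ℓ k m n
        ≡ + p r 0 1 (λ q → ℓ q - + 1) k (m - + 1) (n - (m - + 1) ℤ.* + r)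
          ℤ.+ + p r 0 1 (λ q → ℓ q - + 1) (k - + 1) (m - + 1) (n - (m - + 1) ℤ.* (+ r - + 1)))
    × ((ℓ : Fin r → ℤ) → (k m n : ℤ) →
      p r 1 1 ℓ k m n ≡ p r 0 1 ℓ k m (n - m))
lemma3p1 r@(suc r′) _ =
  (λ j 1≤j j≤2^r∸2 → p₀-difference r (1≤j , <2^r j≤2^r∸2) (succeeds-0-suc r j)) ,
  (λ ℓ k m n → trans (p₀-difference r (allOnes-valid r′) (succeeds-top r) ℓ k m n) (cong₂ (λ x y → + x ℤ.+ + y)
    (p-allOnes-cong ℓ k (m - + 1) (cong (λ e → n - (m - + 1) ℤ.* + e) (w-allOnes r)))
    (p-allOnes-cong ℓ (k - + 1) (m - + 1) (cong (λ e → n - (m - + 1) ℤ.* (+ e - + 1)) (w-allOnes r))))) ,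
  (λ ℓ k m n → trans (p-lowest-shift 1 ℓ k m n) (p-cong r 0 m refl (λ _ → refl) refl (cong (n -_) (ℤ.*-identityʳ m))))
  where
  <2^r : ∀ {j} → j ≤ 2 ^ r ∸ 2 → j < 2 ^ r
  <2^r j≤2^r∸2 = ℕ.≤-<-trans (≤-trans j≤2^r∸2 (ℕ.∸-monoʳ-≤ (2 ^ r) (s≤s z≤n))) (2^r∸1<2^r r)
  p-allOnes-cong : ∀ ℓ k m {n n′} → n ≡ n′ →
    p r 0 (2 ^ v r (2 ^ r ∸ 1)) (λ q → ℓ q - + ε (2 ^ r ∸ 1) (toℕ q)) k m n ≡ p r 0 1 (λ q → ℓ q - + 1) k m n′
  p-allOnes-cong ℓ k m n≡n′ = p-cong r 0 m (cong (2 ^_) (v-allOnes r′))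
    (λ q → cong (λ e → ℓ q - + e) (ε-allOnes r (toℕ q) (toℕ<n q))) refl n≡n′
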